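{- Let $P$ be a general program and $M$ a set of atoms. Then $\mathrm{GenDisj}(P)\cup\neg(\sigma_{\mathrm{GenDisj}(P)}\setminus M)\ \vdash^c_I\ M$ if and only if $P\cup\neg(\sigma_P\setminus M)\ \vdash^c_I\ M$.
   Context: Formulas are propositional over atoms with $\land,\lor,\leftarrow$ (implication, $H\leftarrow B$ meaning "$B$ implies $H$") and $\bot$; $\neg F$ abbreviates $\bot\leftarrow F$, $\top$ abbreviates $\bot\leftarrow\bot$. $\sigma_T$ is the set of atoms occurring in $T$. A general clause is $h_1\lor\dots\lor h_n\leftarrow b_1\land\dots\land b_m$ with each $h_i$ an atom and each $b_j$ a literal ($a$ or $\neg a$); if $n\ge1$ it is a disjunctive clause, if $n=0$ it is a constraint $\bot\leftarrow B$. A general program is a finite set of general clauses. Write $P=D\cup C$ with $D$ its disjunctive clauses and $C$ its constraints; $\mathrm{GenDisj}(P)=D\cup\{p\leftarrow B\land\neg p : (\bot\leftarrow B)\in C\}$, where $p$ is a single new atom not in $\sigma_P$. For a set $S$ of atoms, $\neg S=\{\neg a:a\in S\}$. $T\vdash_I F$ means $(F_1\land\dots\land F_n)\to F$ is a theorem of intuitionistic logic for some $F_i\in T$; $T\vdash_I U$ means $T\vdash_I F$ for all $F\in U$; $T$ is consistent if not $T\vdash_I\bot$; $T\vdash^c_I U$ means $T$ is consistent and $T\vdash_I U$. -}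

module Defs where

open import Data.Nat using (ℕ)
open import Data.List using (List; []; _∷_; _++_; map; concatMap; [_])
open import Data.List.Membership.Propositional using (_∈_; _∉_)
open import Data.List.Relation.Unary.All using (All)
open import Data.Product using (Σ; _×_; _,_)
open import Relation.Nullary using (¬_)
open import Relation.Unary using (Pred)
open import Level using (0ℓ)

Atom : Set
Atom = ℕ

-- Propositional formulas over ∧, ∨, ← and ⊥.
-- (H ⇐ B) is the paper's H ← B, i.e. "B implies H".
infixr 6 _∧_
infixr 5 _∨_
infix 4 _⇐_
data Formula : Set where
  atom : Atom → Formula
  ⊥f   : Formula
  _∧_  : Formula → Formula → Formula
  _∨_  : Formula → Formula → Formula
  _⇐_  : Formula → Formula → Formula

~_ : Formula → Formula
~ F = ⊥f ⇐ F

⊤f : Formula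
⊤f = ⊥f ⇐ ⊥f

infix 2 _⊢_
data _⊢_ (Γ : List Formula) : Formula → Set where
  hyp  : ∀ {A} → A ∈ Γ → Γ ⊢ A
  ∧I   : ∀ {A B} → Γ ⊢ A → Γ ⊢ B → Γ ⊢ A ∧ B
  ∧E₁  : ∀ {A B} → Γ ⊢ A ∧ B → Γ ⊢ A
  ∧E₂  : ∀ {A B} → Γ ⊢ A ∧ B → Γ ⊢ B
  ∨I₁  : ∀ {A B} → Γ ⊢ A → Γ ⊢ A ∨ B
  ∨I₂  : ∀ {A B} → Γ ⊢ B → Γ ⊢ A ∨ B
  ∨E   : ∀ {A B C} → Γ ⊢ A ∨ B → (A ∷ Γ) ⊢ C → (B ∷ Γ) ⊢ C → Γ ⊢ C
  ⇐I   : ∀ {A B} → (B ∷ Γ) ⊢ A → Γ ⊢ A ⇐ B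
  ⇐E   : ∀ {A B} → Γ ⊢ A ⇐ B → Γ ⊢ B → Γ ⊢ A
  ⊥E   : ∀ {A} → Γ ⊢ ⊥f → Γ ⊢ A

Theorem : Formula → Set
Theorem F = [] ⊢ F

⋀ : List Formula → Formula
⋀ [] = ⊤f
⋀ (F ∷ Fs) = F ∧ ⋀ Fs

⋁ : List Formula → Formula
⋁ [] = ⊥f
⋁ (F ∷ Fs) = F ∨ ⋁ Fs

Theory : Set₁
Theory = Pred Formula 0ℓ

_⊢I_ : Theory → Formula → Set
T ⊢I F = Σ (List Formula) λ Fs → All T Fs × Theorem (F ⇐ ⋀ Fs)

_⊢Iₛ_ : Theory → Theory → Set
T ⊢Iₛ U = ∀ F → U F → T ⊢I F

Consistent : Theory → Set
Consistent T = ¬ (T ⊢I ⊥f)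

_⊢ᶜI_ : Theory → Theory → Set
T ⊢ᶜI U = Consistent T × (T ⊢Iₛ U)

AtomSet : Set₁
AtomSet = Pred Atom 0ℓ

atomsTheory : AtomSet → Theory
atomsTheory M F = Σ Atom λ a → M a × F ≡' atom a
  where
  open import Relation.Binary.PropositionalEquality renaming (_≡_ to _≡'_)

data Literal : Set where
  pos : Atom → Literal
  neg : Atom → Literal

litFormula : Literal → Formula
litFormula (pos a) = atom a
litFormula (neg a) = ~ atom a

litAtom : Literal → Atom
litAtom (pos a) = a
litAtom (neg a) = a

-- h₁ ∨ … ∨ hₙ ← b₁ ∧ … ∧ bₘ  (n = 0 : constraint)
record Clause : Set where
  constructor _⟵_
  field
    heads : List Atom
    body  : List Literal
open Clause public

clauseFormula : Clause → Formula
clauseFormula (hs ⟵ bs) = ⋁ (map atom hs) ⇐ ⋀ (map litFormula bs)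

Program : Set
Program = List Clause

σClause : Clause → List Atom
σClause (hs ⟵ bs) = hs ++ map litAtom bs

σ : Program → List Atom
σ P = concatMap σClause P

-- GenDisj with the new atom p: disjunctive clauses kept, each constraint
-- ⊥ ← B replaced by p ← B ∧ ¬p.
genDisjClause : Atom → Clause → Clause
genDisjClause p ([] ⟵ bs)      = [ p ] ⟵ (bs ++ [ neg p ])
genDisjClause p ((h ∷ hs) ⟵ bs) = (h ∷ hs) ⟵ bs

GenDisj : Program → Atom → Program
GenDisj P p = map (genDisjClause p) P

programTheory : Program → AtomSet → Theory
programTheory P M F =
  Σ Clause (λ c → c ∈ P × F ≡' clauseFormula c)
  ⊎ Σ Atom (λ a → a ∈ σ P × ¬ M a × F ≡' (~ atom a))
  where
  open import Relation.Binary.PropositionalEquality renaming (_≡_ to _≡'_)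
  open import Data.Sum using (_⊎_)

-- Write T for P ∪ ¬(σ_P ∖ M) and T′ for GenDisj(P) ∪ ¬(σ_GenDisj(P) ∖ M).
-- Each side of the equivalence forces p ∉ M. A derivation of p from T becomes
-- one of ⊥ after substituting ⊥ for p, which does not occur in T. A derivation
-- of p from T′ is refuted by the two-world Kripke model in which p holds only in
-- the upper world: if p ∈ M then ¬p ∉ T′, and every member of T′ holds in the
-- lower world, p ← B ∧ ¬p because ¬p fails there.
-- Once p ∉ M we have ¬p ∈ T′, so T′ derives T (⊥ ← B follows from p ← B ∧ ¬p
-- and ¬p), while T ∪ {¬p} derives T′. Substituting ⊥ for p then discharges ¬p:
-- it fixes T and ⊥, and sends an atom a to a or to ⊥.

module Submission where

open import Defs
open import Data.List.Membership.Propositional using (_∉_)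
open import Function.Bundles using (_⇔_; mk⇔)

open import Data.Nat using (_≟_)
open import Data.List using (List; []; _∷_; _++_; map; [_])
open import Data.List.Properties using (map-++)
open import Data.List.Membership.Propositional using (_∈_; find; lose)
open import Data.List.Membership.Propositional.Properties
  using (∈-map⁺; ∈-map⁻; ∈-++⁺ˡ; ∈-++⁺ʳ; ∈-++⁻; ∈-concatMap⁺; ∈-concatMap⁻)
open import Data.List.Relation.Binary.Subset.Propositional using (_⊆_)
open import Data.List.Relation.Binary.Subset.Propositional.Properties
  using (∷⁺ʳ; map⁺; xs⊆xs++ys; xs⊆ys++xs)
open import Data.List.Relation.Unary.Any using (here; there)
open import Data.List.Relation.Unary.All using (All; []; _∷_; lookup)
open import Data.List.Relation.Unary.All.Properties using (++⁺)
open import Data.Product using (Σ; _×_; _,_)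
open import Data.Sum using (_⊎_; inj₁; inj₂; [_,_]′)
open import Function using (_∘_; id)
open import Relation.Nullary using (¬_; yes; no; contradiction)
open import Relation.Binary.PropositionalEquality
  using (_≡_; _≢_; refl; sym; subst; cong₂)

infix 2 _⊢*_

_⊢*_ : List Formula → List Formula → Set
Δ ⊢* Γ = ∀ {G} → G ∈ Γ → Δ ⊢ G

#0 : ∀ {Γ A} → A ∷ Γ ⊢ A
#0 = hyp (here refl)

#1 : ∀ {Γ A B} → B ∷ A ∷ Γ ⊢ A
#1 = hyp (there (here refl))

#2 : ∀ {Γ A B C} → C ∷ B ∷ A ∷ Γ ⊢ A
#2 = hyp (there (there (here refl)))

#3 : ∀ {Γ A B C D} → D ∷ C ∷ B ∷ A ∷ Γ ⊢ A
#3 = hyp (there (there (there (here refl))))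

weaken : ∀ {Γ Δ F} → Γ ⊆ Δ → Γ ⊢ F → Δ ⊢ F
weaken ρ (hyp x)    = hyp (ρ x)
weaken ρ (∧I d e)   = ∧I (weaken ρ d) (weaken ρ e)
weaken ρ (∧E₁ d)    = ∧E₁ (weaken ρ d)
weaken ρ (∧E₂ d)    = ∧E₂ (weaken ρ d)
weaken ρ (∨I₁ d)    = ∨I₁ (weaken ρ d)
weaken ρ (∨I₂ d)    = ∨I₂ (weaken ρ d)
weaken ρ (∨E d e f) = ∨E (weaken ρ d) (weaken (∷⁺ʳ _ ρ) e) (weaken (∷⁺ʳ _ ρ) f)
weaken ρ (⇐I d)     = ⇐I (weaken (∷⁺ʳ _ ρ) d)
weaken ρ (⇐E d e)   = ⇐E (weaken ρ d) (weaken ρ e)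
weaken ρ (⊥E d)     = ⊥E (weaken ρ d)

⊢*-∷ : ∀ {Γ Δ A} → Δ ⊢* Γ → A ∷ Δ ⊢* A ∷ Γ
⊢*-∷ σ (here refl) = #0
⊢*-∷ σ (there x)   = weaken there (σ x)

substitute : ∀ {Γ Δ F} → Δ ⊢* Γ → Γ ⊢ F → Δ ⊢ F
substitute σ (hyp x)    = σ x
substitute σ (∧I d e)   = ∧I (substitute σ d) (substitute σ e)
substitute σ (∧E₁ d)    = ∧E₁ (substitute σ d)
substitute σ (∧E₂ d)    = ∧E₂ (substitute σ d)
substitute σ (∨I₁ d)    = ∨I₁ (substitute σ d)
substitute σ (∨I₂ d)    = ∨I₂ (substitute σ d)
substitute σ (∨E d e f) = ∨E (substitute σ d) (substitute (⊢*-∷ σ) e) (substitute (⊢*-∷ σ) f)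
substitute σ (⇐I d)     = ⇐I (substitute (⊢*-∷ σ) d)
substitute σ (⇐E d e)   = ⇐E (substitute σ d) (substitute σ e)
substitute σ (⊥E d)     = ⊥E (substitute σ d)

⊢-cut : ∀ {Γ A B} → A ∷ [] ⊢ B → Γ ⊢ A → Γ ⊢ B
⊢-cut d e = substitute (λ { (here refl) → e ; (there ()) }) d

⋀-intro : ∀ {Γ Gs} → Γ ⊢* Gs → Γ ⊢ ⋀ Gs
⋀-intro {Gs = []}     _ = ⇐I #0
⋀-intro {Gs = G ∷ Gs} σ = ∧I (σ (here refl)) (⋀-intro (σ ∘ there))

⋀-elim : ∀ {Γ Gs G} → Γ ⊢ ⋀ Gs → G ∈ Gs → Γ ⊢ G
⋀-elim d (here refl) = ∧E₁ d
⋀-elim d (there x)   = ⋀-elim (∧E₂ d) x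

⋀-⊆ : ∀ {Γ Fs Gs} → Fs ⊆ Gs → Γ ⊢ ⋀ Gs → Γ ⊢ ⋀ Fs
⋀-⊆ Fs⊆Gs d = ⋀-intro (⋀-elim d ∘ Fs⊆Gs)

⋀-++⁺ : ∀ {Γ} Fs {Gs} → Γ ⊢ ⋀ Fs → Γ ⊢ ⋀ Gs → Γ ⊢ ⋀ (Fs ++ Gs)
⋀-++⁺ Fs d e = ⋀-intro ([ ⋀-elim d , ⋀-elim e ]′ ∘ ∈-++⁻ Fs)

infix 2 _⊩_

_⊩_ : Theory → Formula → Set
T ⊩ F = Σ (List Formula) λ Γ → All T Γ × (Γ ⊢ F)

⊢I⇒⊩ : ∀ {T F} → T ⊢I F → T ⊩ F
⊢I⇒⊩ (Γ , tΓ , d) = Γ , tΓ , ⇐E (weaken (λ ()) d) (⋀-intro hyp)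

⊩⇒⊢I : ∀ {T F} → T ⊩ F → T ⊢I F
⊩⇒⊢I (Γ , tΓ , d) = Γ , tΓ , ⇐I (substitute (⋀-elim #0) d)

⊩-member : ∀ {T : Theory} {F} → T F → T ⊩ F
⊩-member t = _ , t ∷ [] , #0

⊩-⊢ : ∀ {T A B} → T ⊩ A → A ∷ [] ⊢ B → T ⊩ B
⊩-⊢ (Γ , tΓ , d) e = Γ , tΓ , ⊢-cut e d

⊩-cut : ∀ {T Γ F} → (∀ {G} → G ∈ Γ → T ⊩ G) → Γ ⊢ F → T ⊩ F
⊩-cut {Γ = []}    _ d = [] , [] , d
⊩-cut {Γ = A ∷ Γ} h d with h (here refl) | ⊩-cut (h ∘ there) (⇐I d)
... | Δ₁ , t₁ , a | Δ₂ , t₂ , f =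
  Δ₁ ++ Δ₂ , ++⁺ t₁ t₂ , ⇐E (weaken (xs⊆ys++xs Δ₂ Δ₁) f) (weaken (xs⊆xs++ys Δ₁ Δ₂) a)

⊩-trans : ∀ {T₁ T₂ G} → (∀ {F} → T₁ F → T₂ ⊩ F) → T₁ ⊩ G → T₂ ⊩ G
⊩-trans h (Γ , tΓ , d) = ⊩-cut (h ∘ lookup tΓ) d

⊩-map : ∀ {T₁ T₂ G} (f : Formula → Formula) →
        (∀ {Γ F} → Γ ⊢ F → map f Γ ⊢ f F) →
        (∀ {F} → T₁ F → T₂ ⊩ f F) → T₁ ⊩ G → T₂ ⊩ f G
⊩-map {T₂ = T₂} f f-sound h (Γ , tΓ , d) = ⊩-cut translated (f-sound d)
  where
  translated : ∀ {G} → G ∈ map f Γ → T₂ ⊩ G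
  translated x with ∈-map⁻ f x
  ... | F , F∈Γ , refl = h (lookup tΓ F∈Γ)

⊢I-trans : ∀ {T₁ T₂ G} → (∀ {F} → T₁ F → T₂ ⊩ F) → T₁ ⊢I G → T₂ ⊢I G
⊢I-trans h = ⊩⇒⊢I ∘ ⊩-trans h ∘ ⊢I⇒⊩

infix 8 _[_≔_]

_[_≔_] : Formula → Atom → Formula → Formula
atom a  [ p ≔ s ] with p ≟ a
... | yes _ = s
... | no _  = atom a
⊥f      [ p ≔ s ] = ⊥f
(A ∧ B) [ p ≔ s ] = A [ p ≔ s ] ∧ B [ p ≔ s ]
(A ∨ B) [ p ≔ s ] = A [ p ≔ s ] ∨ B [ p ≔ s ]
(A ⇐ B) [ p ≔ s ] = A [ p ≔ s ] ⇐ B [ p ≔ s ]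

≔-self : ∀ p s → atom p [ p ≔ s ] ≡ s
≔-self p s with p ≟ p
... | yes _   = refl
... | no p≢p = contradiction refl p≢p

⊢-[≔] : ∀ {p s Γ F} → Γ ⊢ F → map (_[ p ≔ s ]) Γ ⊢ F [ p ≔ s ]
⊢-[≔] {p} {s} (hyp x) = hyp (∈-map⁺ (_[ p ≔ s ]) x)
⊢-[≔] (∧I d e)   = ∧I (⊢-[≔] d) (⊢-[≔] e)
⊢-[≔] (∧E₁ d)    = ∧E₁ (⊢-[≔] d)
⊢-[≔] (∧E₂ d)    = ∧E₂ (⊢-[≔] d)
⊢-[≔] (∨I₁ d)    = ∨I₁ (⊢-[≔] d)
⊢-[≔] (∨I₂ d)    = ∨I₂ (⊢-[≔] d)
⊢-[≔] (∨E d e f) = ∨E (⊢-[≔] d) (⊢-[≔] e) (⊢-[≔] f)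
⊢-[≔] (⇐I d)     = ⇐I (⊢-[≔] d)
⊢-[≔] (⇐E d e)   = ⇐E (⊢-[≔] d) (⊢-[≔] e)
⊢-[≔] (⊥E d)     = ⊥E (⊢-[≔] d)

[≔⊥]-atom : ∀ p a → atom a [ p ≔ ⊥f ] ∷ [] ⊢ atom a
[≔⊥]-atom p a with p ≟ a
... | yes _ = ⊥E #0
... | no _  = #0

data Fresh (p : Atom) : Formula → Set where
  atom : ∀ {a} → p ≢ a → Fresh p (atom a)
  ⊥f   : Fresh p ⊥f
  _∧_  : ∀ {A B} → Fresh p A → Fresh p B → Fresh p (A ∧ B)
  _∨_  : ∀ {A B} → Fresh p A → Fresh p B → Fresh p (A ∨ B)
  _⇐_  : ∀ {A B} → Fresh p A → Fresh p B → Fresh p (A ⇐ B)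

fresh-[≔] : ∀ {p s F} → Fresh p F → F [ p ≔ s ] ≡ F
fresh-[≔] {p} (atom {a} p≢a) with p ≟ a
... | yes p≡a = contradiction p≡a p≢a
... | no _    = refl
fresh-[≔] ⊥f      = refl
fresh-[≔] (A ∧ B) = cong₂ _∧_ (fresh-[≔] A) (fresh-[≔] B)
fresh-[≔] (A ∨ B) = cong₂ _∨_ (fresh-[≔] A) (fresh-[≔] B)
fresh-[≔] (A ⇐ B) = cong₂ _⇐_ (fresh-[≔] A) (fresh-[≔] B)

-- ↓ F and ↑ F internalise the truth of F in the lower and the upper world of
-- the two-world Kripke model in which p is false below and true above, while
-- the other atoms are read as themselves in both worlds.
module Kripke (p : Atom) where

  ↑ : Formula → Formula
  ↑ F = F [ p ≔ ⊤f ]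

  ↓ : Formula → Formula
  ↓ (atom a) = atom a [ p ≔ ⊥f ]
  ↓ ⊥f       = ⊥f
  ↓ (A ∧ B)  = ↓ A ∧ ↓ B
  ↓ (A ∨ B)  = ↓ A ∨ ↓ B
  ↓ (A ⇐ B)  = (↓ A ⇐ ↓ B) ∧ (↑ A ⇐ ↑ B)

  ↓⇒↑ : ∀ F → ↓ F ∷ [] ⊢ ↑ F
  ↓⇒↑ (atom a) with p ≟ a
  ... | yes _ = ⊥E #0
  ... | no _  = #0
  ↓⇒↑ ⊥f      = #0
  ↓⇒↑ (A ∧ B) = ∧I (⊢-cut (↓⇒↑ A) (∧E₁ #0)) (⊢-cut (↓⇒↑ B) (∧E₂ #0))
  ↓⇒↑ (A ∨ B) = ∨E #0 (∨I₁ (⊢-cut (↓⇒↑ A) #0)) (∨I₂ (⊢-cut (↓⇒↑ B) #0))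
  ↓⇒↑ (A ⇐ B) = ∧E₂ #0

  ↓-sound : ∀ {Γ F} → Γ ⊢ F → map ↓ Γ ⊢ ↓ F
  ↓-sound (hyp x)    = hyp (∈-map⁺ ↓ x)
  ↓-sound (∧I d e)   = ∧I (↓-sound d) (↓-sound e)
  ↓-sound (∧E₁ d)    = ∧E₁ (↓-sound d)
  ↓-sound (∧E₂ d)    = ∧E₂ (↓-sound d)
  ↓-sound (∨I₁ d)    = ∨I₁ (↓-sound d)
  ↓-sound (∨I₂ d)    = ∨I₂ (↓-sound d)
  ↓-sound (∨E d e f) = ∨E (↓-sound d) (↓-sound e) (↓-sound f)
  ↓-sound {Γ} (⇐I {B = B} d) = ∧I (⇐I (↓-sound d)) (⇐I (substitute ↑-context (⊢-[≔] d)))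
    where
    ↑-context : ↑ B ∷ map ↓ Γ ⊢* map ↑ (B ∷ Γ)
    ↑-context (here refl) = #0
    ↑-context (there x) with ∈-map⁻ ↑ x
    ... | H , H∈Γ , refl = ⊢-cut (↓⇒↑ H) (hyp (there (∈-map⁺ ↓ H∈Γ)))
  ↓-sound (⇐E d e)   = ⇐E (∧E₁ (↓-sound d)) (↓-sound e)
  ↓-sound (⊥E d)     = ⊥E (↓-sound d)

  fresh⇒↓ : ∀ {F} → Fresh p F → F ∷ [] ⊢ ↓ F
  ↓⇒fresh : ∀ {F} → Fresh p F → ↓ F ∷ [] ⊢ F

  fresh⇒↓ (atom {a} p≢a) with p ≟ a
  ... | yes p≡a = contradiction p≡a p≢a
  ... | no _    = #0
  fresh⇒↓ ⊥f      = #0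
  fresh⇒↓ (A ∧ B) = ∧I (⊢-cut (fresh⇒↓ A) (∧E₁ #0)) (⊢-cut (fresh⇒↓ B) (∧E₂ #0))
  fresh⇒↓ (A ∨ B) = ∨E #0 (∨I₁ (⊢-cut (fresh⇒↓ A) #0)) (∨I₂ (⊢-cut (fresh⇒↓ B) #0))
  fresh⇒↓ {F} (A ⇐ B) =
    ∧I (⇐I (⊢-cut (fresh⇒↓ A) (⇐E #1 (⊢-cut (↓⇒fresh B) #0))))
       (subst (F ∷ [] ⊢_) (sym (fresh-[≔] (A ⇐ B))) #0)

  ↓⇒fresh (atom {a} p≢a) with p ≟ a
  ... | yes p≡a = contradiction p≡a p≢a
  ... | no _    = #0
  ↓⇒fresh ⊥f      = #0
  ↓⇒fresh (A ∧ B) = ∧I (⊢-cut (↓⇒fresh A) (∧E₁ #0)) (⊢-cut (↓⇒fresh B) (∧E₂ #0))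
  ↓⇒fresh (A ∨ B) = ∨E #0 (∨I₁ (⊢-cut (↓⇒fresh A) #0)) (∨I₂ (⊢-cut (↓⇒fresh B) #0))
  ↓⇒fresh (A ⇐ B) = ⇐I (⊢-cut (↓⇒fresh A) (⇐E (∧E₁ #1) (⊢-cut (fresh⇒↓ B) #0)))

  ↑p : ∀ {Γ} → Γ ⊢ ↑ (atom p)
  ↑p = subst (_ ⊢_) (sym (≔-self p ⊤f)) (⇐I #0)

  ↓¬p⇒⊥ : ∀ {Γ} → Γ ⊢ ↓ (~ atom p) → Γ ⊢ ⊥f
  ↓¬p⇒⊥ d = ⇐E (∧E₂ d) ↑p

  ↓-closed-⊬p : ∀ {T} → (∀ {F} → T F → T ⊩ ↓ F) → T ⊩ atom p → T ⊩ ⊥f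
  ↓-closed-⊬p {T} h = subst (T ⊩_) (≔-self p ⊥f) ∘ ⊩-map ↓ ↓-sound h

σ-⊆ : ∀ {c P} → c ∈ P → σClause c ⊆ σ P
σ-⊆ c∈P x = ∈-concatMap⁺ σClause (lose c∈P x)

σClause-⊆-genDisj : ∀ p c → σClause c ⊆ σClause (genDisjClause p c)
σClause-⊆-genDisj p ([] ⟵ bs)       = there ∘ map⁺ litAtom (xs⊆xs++ys bs _)
σClause-⊆-genDisj p ((h ∷ hs) ⟵ bs) = id

σClause-genDisj-⊆ : ∀ p c → σClause (genDisjClause p c) ⊆ p ∷ σClause c
σClause-genDisj-⊆ p ([] ⟵ bs) (here a≡p) = here a≡p
σClause-genDisj-⊆ p ([] ⟵ bs) (there x)
  with ∈-++⁻ (map litAtom bs) (subst (_ ∈_) (map-++ litAtom bs [ neg p ]) x)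
... | inj₁ a∈bs       = there a∈bs
... | inj₂ (here a≡p) = here a≡p
σClause-genDisj-⊆ p ((h ∷ hs) ⟵ bs) = there

σ-⊆-GenDisj : ∀ P p → σ P ⊆ σ (GenDisj P p)
σ-⊆-GenDisj P p x with find (∈-concatMap⁻ σClause {xs = P} x)
... | c , c∈P , a∈c = σ-⊆ (∈-map⁺ (genDisjClause p) c∈P) (σClause-⊆-genDisj p c a∈c)

σ-GenDisj-⊆ : ∀ P p → σ (GenDisj P p) ⊆ p ∷ σ P
σ-GenDisj-⊆ P p x with find (∈-concatMap⁻ σClause {xs = GenDisj P p} x)
... | c′ , c′∈ , a∈c′ with ∈-map⁻ (genDisjClause p) c′∈
... | c , c∈P , refl = ∷⁺ʳ p (σ-⊆ c∈P) (σClause-genDisj-⊆ p c a∈c′)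

fresh-heads : ∀ {p} hs → p ∉ hs → Fresh p (⋁ (map atom hs))
fresh-heads []       _  = ⊥f
fresh-heads (h ∷ hs) p∉ = atom (p∉ ∘ here) ∨ fresh-heads hs (p∉ ∘ there)

fresh-literal : ∀ {p} b → p ≢ litAtom b → Fresh p (litFormula b)
fresh-literal (pos a) p≢a = atom p≢a
fresh-literal (neg a) p≢a = ⊥f ⇐ atom p≢a

fresh-body : ∀ {p} bs → p ∉ map litAtom bs → Fresh p (⋀ (map litFormula bs))
fresh-body []       _  = ⊥f ⇐ ⊥f
fresh-body (b ∷ bs) p∉ = fresh-literal b (p∉ ∘ here) ∧ fresh-body bs (p∉ ∘ there)

fresh-clause : ∀ {p} c → p ∉ σClause c → Fresh p (clauseFormula c)
fresh-clause (hs ⟵ bs) p∉ = fresh-heads hs (p∉ ∘ ∈-++⁺ˡ) ⇐ fresh-body bs (p∉ ∘ ∈-++⁺ʳ hs)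

module GenDisjTheories (P : Program) (M : AtomSet) (p : Atom) (p∉σP : p ∉ σ P) where

  open Kripke p

  T T′ T∪¬p : Theory
  T       = programTheory P M
  T′      = programTheory (GenDisj P p) M
  T∪¬p F  = T F ⊎ F ≡ ~ atom p

  genDisj-∈ : ∀ {c} → c ∈ P → genDisjClause p c ∈ GenDisj P p
  genDisj-∈ = ∈-map⁺ (genDisjClause p)

  T-fresh : ∀ {F} → T F → Fresh p F
  T-fresh (inj₁ (c , c∈P , refl))      = fresh-clause c (p∉σP ∘ σ-⊆ c∈P)
  T-fresh (inj₂ (a , a∈σP , _ , refl)) = ⊥f ⇐ atom λ { refl → p∉σP a∈σP }

  T∪¬p-⊩-T′ : ∀ {F} → T′ F → T∪¬p ⊩ F
  T∪¬p-⊩-T′ (inj₁ (c′ , c′∈ , refl)) with ∈-map⁻ (genDisjClause p) c′∈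
  ... | (h ∷ hs) ⟵ bs , c∈P , refl = ⊩-member (inj₁ (inj₁ (_ , c∈P , refl)))
  ... | [] ⟵ bs , c∈P , refl =
    ⊩-⊢ (⊩-member (inj₁ (inj₁ (_ , c∈P , refl))))
        (⇐I (⊥E (⇐E #1 (⋀-⊆ (map⁺ litFormula (xs⊆xs++ys bs _)) #0))))
  T∪¬p-⊩-T′ (inj₂ (a , a∈σ′ , a∉M , refl)) with σ-GenDisj-⊆ P p a∈σ′
  ... | here refl  = ⊩-member (inj₂ refl)
  ... | there a∈σP = ⊩-member (inj₁ (inj₂ (a , a∈σP , a∉M , refl)))

  T⊩T∪¬p[≔⊥] : ∀ {F} → T∪¬p F → T ⊩ F [ p ≔ ⊥f ]
  T⊩T∪¬p[≔⊥] (inj₁ t)    = subst (T ⊩_) (sym (fresh-[≔] (T-fresh t))) (⊩-member t)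
  T⊩T∪¬p[≔⊥] (inj₂ refl) = [] , [] , ⇐I (subst (λ X → X ∷ [] ⊢ ⊥f) (sym (≔-self p ⊥f)) #0)

  T⊩[≔⊥] : ∀ {G} → T ⊩ G → T ⊩ G [ p ≔ ⊥f ]
  T⊩[≔⊥] = ⊩-map (_[ p ≔ ⊥f ]) ⊢-[≔] (T⊩T∪¬p[≔⊥] ∘ inj₁)

  T′⊩⇒T⊩[≔⊥] : ∀ {G} → T′ ⊩ G → T ⊩ G [ p ≔ ⊥f ]
  T′⊩⇒T⊩[≔⊥] = ⊩-map (_[ p ≔ ⊥f ]) ⊢-[≔] T⊩T∪¬p[≔⊥] ∘ ⊩-trans T∪¬p-⊩-T′

  T′-⊩-T : ¬ M p → ∀ {F} → T F → T′ ⊩ F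
  T′-⊩-T p∉M (inj₂ (a , a∈σP , a∉M , refl)) =
    ⊩-member (inj₂ (a , σ-⊆-GenDisj P p a∈σP , a∉M , refl))
  T′-⊩-T p∉M (inj₁ ((h ∷ hs) ⟵ bs , c∈P , refl)) = ⊩-member (inj₁ (_ , genDisj-∈ c∈P , refl))
  T′-⊩-T p∉M (inj₁ ([] ⟵ bs , c∈P , refl)) = ⊩-cut members constraint
    where
    members : ∀ {G} → G ∈ _ → T′ ⊩ G
    members (here refl)         = ⊩-member (inj₁ (_ , genDisj-∈ c∈P , refl))
    members (there (here refl)) =
      ⊩-member (inj₂ (p , σ-⊆ (genDisj-∈ c∈P) (here refl) , p∉M , refl))
    members (there (there ()))
    body⁺ : ∀ {Γ} → Γ ⊢ ⋀ (map litFormula bs) → Γ ⊢ ~ atom p →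
            Γ ⊢ ⋀ (map litFormula (bs ++ [ neg p ]))
    body⁺ {Γ} B ¬p = subst (λ Gs → Γ ⊢ ⋀ Gs) (sym (map-++ litFormula bs [ neg p ]))
                           (⋀-++⁺ (map litFormula bs) B (∧I ¬p (⇐I #0)))
    constraint : clauseFormula (genDisjClause p ([] ⟵ bs)) ∷ ~ atom p ∷ []
                 ⊢ clauseFormula ([] ⟵ bs)
    constraint = ⇐I (∨E (⇐E #1 (body⁺ #0 #2)) (⇐E #3 #0) #0)

  T′-↓-closed : M p → ∀ {F} → T′ F → T′ ⊩ ↓ F
  T′-↓-closed Mp (inj₁ (c′ , c′∈ , refl)) with ∈-map⁻ (genDisjClause p) c′∈
  ... | (h ∷ hs) ⟵ bs , c∈P , refl =
    ⊩-⊢ (⊩-member (inj₁ (_ , c′∈ , refl))) (fresh⇒↓ (T-fresh (inj₁ (_ , c∈P , refl))))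
  ... | [] ⟵ bs , c∈P , refl = [] , [] , ∧I (⇐I (⊥E (↓¬p⇒⊥ (↓-sound ¬p-in-body)))) (⇐I (∨I₁ ↑p))
    where
    ¬p-in-body : ⋀ (map litFormula (bs ++ [ neg p ])) ∷ [] ⊢ ~ atom p
    ¬p-in-body = ⋀-elim #0 (∈-map⁺ litFormula (∈-++⁺ʳ bs (here refl)))
  T′-↓-closed Mp (inj₂ (a , a∈σ′ , a∉M , refl)) =
    ⊩-⊢ (⊩-member (inj₂ (a , a∈σ′ , a∉M , refl))) (fresh⇒↓ (⊥f ⇐ atom λ { refl → a∉M Mp }))

  p∉M-from-T : T ⊢ᶜI atomsTheory M → ¬ M p
  p∉M-from-T (con , der) Mp =
    con (⊩⇒⊢I (subst (T ⊩_) (≔-self p ⊥f) (T⊩[≔⊥] (⊢I⇒⊩ (der _ (p , Mp , refl))))))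

  p∉M-from-T′ : T′ ⊢ᶜI atomsTheory M → ¬ M p
  p∉M-from-T′ (con′ , der′) Mp =
    con′ (⊩⇒⊢I (↓-closed-⊬p (T′-↓-closed Mp) (⊢I⇒⊩ (der′ _ (p , Mp , refl)))))

  consistent-T⇒T′ : Consistent T → Consistent T′
  consistent-T⇒T′ con = con ∘ ⊩⇒⊢I ∘ T′⊩⇒T⊩[≔⊥] ∘ ⊢I⇒⊩

  atoms-T′⇒T : T′ ⊢Iₛ atomsTheory M → T ⊢Iₛ atomsTheory M
  atoms-T′⇒T der′ _ (a , Ma , refl) =
    ⊩⇒⊢I (⊩-⊢ (T′⊩⇒T⊩[≔⊥] (⊢I⇒⊩ (der′ _ (a , Ma , refl)))) ([≔⊥]-atom p a))

lemma4p3 : (P : Program) (M : AtomSet) (p : Atom) → p ∉ σ P →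
    (programTheory (GenDisj P p) M ⊢ᶜI atomsTheory M) ⇔ (programTheory P M ⊢ᶜI atomsTheory M)
lemma4p3 P M p p∉σP = mk⇔ to from
  where
  open GenDisjTheories P M p p∉σP

  to : T′ ⊢ᶜI atomsTheory M → T ⊢ᶜI atomsTheory M
  to ⊢ᶜ′@(con′ , der′) =
    con′ ∘ ⊢I-trans (T′-⊩-T (p∉M-from-T′ ⊢ᶜ′)) , atoms-T′⇒T der′

  from : T ⊢ᶜI atomsTheory M → T′ ⊢ᶜI atomsTheory M
  from ⊢ᶜ@(con , der) =
    consistent-T⇒T′ con , λ F F∈M → ⊢I-trans (T′-⊩-T (p∉M-from-T ⊢ᶜ)) (der F F∈M)
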